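{- Let $(X,d)$ be an ultrametric space whose value set $\Gamma$ is linearly ordered, and let $(X,\mathcal{B}_d)$ be its ultrametric ball space. Then: 1) the ball space $(X,\operatorname{ci}(\mathcal{B}_d))$ is chain intersection closed; 2) if $(X,\mathcal{B}_d)$ is spherically complete, then so is $(X,\operatorname{ci}(\mathcal{B}_d))$.
   Context: A ball space $(X,\mathcal{B})$ is a nonempty set $X$ with a nonempty collection $\mathcal{B}$ of nonempty subsets of $X$. A chain in $\mathcal{B}$ is a nonempty subset of $\mathcal{B}$ linearly ordered by inclusion. $(X,\mathcal{B})$ is spherically complete if every chain in $\mathcal{B}$ has nonempty intersection. $\operatorname{ci}(\mathcal{B})$ is the family of all nonempty sets of the form $\bigcap\mathcal{C}$ with $\mathcal{C}\subseteq\mathcal{B}$ a (nonempty) chain. $(X,\mathcal{B})$ is chain intersection closed if the intersection of every chain in $\mathcal{B}$ is empty or belongs to $\mathcal{B}$, i.e. $\operatorname{ci}(\mathcal{B})=\mathcal{B}$. An ultrametric on $X$ is a map $d:X\times X\to\Gamma$, $\Gamma$ a poset with least element $\bot$, such that for all $x,y,z\in X$, $\gamma\in\Gamma$: $d(x,y)=\bot$ iff $x=y$; if $d(x,y)\le\gamma$ and $d(y,z)\le\gamma$ then $d(x,z)\le\gamma$; $d(x,y)=d(y,x)$. For $x,y\in X$, $B(x,y)=\{z\in X: d(x,z)\le d(x,y)\}$, and $\mathcal{B}_d=\{B(x,y):x,y\in X\}$. -}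

module Defs where

open import Level using (Level; 0ℓ; Lift; _⊔_) renaming (suc to lsuc)
open import Data.Product using (Σ; _×_; _,_)
open import Data.Sum using (_⊎_)
open import Relation.Nullary using (¬_)
open import Relation.Binary.PropositionalEquality using (_≡_)
open import Relation.Binary.Bundles using (TotalOrder)
open import Function.Bundles using (_⇔_)

Subset : Set → Set₁
Subset X = X → Set

-- A collection of subsets of X is a predicate on subsets (universe-polymorphic,
-- since ci(𝓑) quantifies over sub-collections of 𝓑 and thus lives one level up).
Family : Set → (ℓ : Level) → Set (lsuc 0ℓ ⊔ lsuc ℓ)
Family X ℓ = Subset X → Set ℓ

module _ {X : Set} where

  _⊆_ : Subset X → Subset X → Set
  S ⊆ T = ∀ x → S x → T x

  NonEmpty : Subset X → Set
  NonEmpty S = Σ X S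

  ⋂ : ∀ {ℓ} → Family X ℓ → X → Set (lsuc 0ℓ ⊔ ℓ)
  ⋂ 𝓒 x = ∀ S → 𝓒 S → S x

  record IsChainIn {ℓ} (𝓑 𝓒 : Family X ℓ) : Set (lsuc 0ℓ ⊔ ℓ) where
    field
      sub       : ∀ S → 𝓒 S → 𝓑 S
      inhabited : Σ (Subset X) 𝓒
      linear    : ∀ S T → 𝓒 S → 𝓒 T → (S ⊆ T) ⊎ (T ⊆ S)

  SphericallyComplete : ∀ {ℓ} → Family X ℓ → Set (lsuc 0ℓ ⊔ lsuc ℓ)
  SphericallyComplete 𝓑 = ∀ 𝓒 → IsChainIn 𝓑 𝓒 → Σ X (⋂ 𝓒)

  ci : ∀ {ℓ} → Family X ℓ → Family X (lsuc 0ℓ ⊔ lsuc ℓ)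
  ci 𝓑 S = Σ (Family X _) λ 𝓒 →
             IsChainIn 𝓑 𝓒 × (∀ x → (S x → ⋂ 𝓒 x) × (⋂ 𝓒 x → S x)) × NonEmpty S

  ChainIntersectionClosed : ∀ {ℓ} → Family X ℓ → Set (lsuc 0ℓ ⊔ lsuc ℓ)
  ChainIntersectionClosed 𝓑 =
    ∀ 𝓒 → IsChainIn 𝓑 𝓒 →
      (¬ Σ X (⋂ 𝓒)) ⊎
      (Σ (Subset X) λ S → 𝓑 S × (∀ x → (S x → ⋂ 𝓒 x) × (⋂ 𝓒 x → S x)))

record IsUltrametric (X : Set) (Γ : TotalOrder 0ℓ 0ℓ 0ℓ)
                     (⊥Γ : TotalOrder.Carrier Γ)
                     (d : X → X → TotalOrder.Carrier Γ) : Set where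
  open TotalOrder Γ
  field
    ⊥-least : ∀ γ → ⊥Γ ≤ γ
    d-zero  : ∀ x y → (d x y ≈ ⊥Γ) ⇔ (x ≡ y)
    d-ultra : ∀ x y z γ → d x y ≤ γ → d y z ≤ γ → d x z ≤ γ
    d-sym   : ∀ x y → d x y ≈ d y x

module _ {X : Set} (Γ : TotalOrder 0ℓ 0ℓ 0ℓ) (d : X → X → TotalOrder.Carrier Γ) where
  open TotalOrder Γ

  Ball : X → X → Subset X
  Ball x y z = d x z ≤ d x y

  𝓑d : Family X (lsuc 0ℓ)
  𝓑d S = Lift _ (Σ X λ x → Σ X λ y → (S ⊆ Ball x y) × (Ball x y ⊆ S))

-- Two balls of an ultrametric space with a common point are nested (as Γ is linear).
-- If S ⊆ S' are members of a chain in ci(𝓑_d), intersections of chains of balls,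
-- then every ball containing S meets every ball containing S' (in any point of S).
-- So the balls of all the witnessing chains together form one chain of balls, with
-- the same intersection as the original chain; both claims follow from this.
module Submission where

open import Defs
open import Level using (0ℓ; Lift; lift; lower; _⊔_) renaming (suc to lsuc)
open import Data.Product using (_×_; Σ; _,_; proj₁; proj₂; map₂; swap)
open import Data.Sum using (_⊎_; inj₁; inj₂)
open import Relation.Binary.Bundles using (TotalOrder)
open import Function using (_∘_)
open import Axiom.ExcludedMiddle using (ExcludedMiddle)
open import Relation.Nullary using (yes; no)
open import Relation.Nullary.Decidable using (True; toWitness; fromWitness; map′)

ExcludedMiddle-lower : ∀ {a} b → ExcludedMiddle (a ⊔ b) → ExcludedMiddle a
ExcludedMiddle-lower b em = map′ lower lift (em {Lift b _})

-- Excluded middle gives propositional resizing: P is replaced by True (em {P}) : Set.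
-- This is needed because ci(𝓑) lives in a higher universe than 𝓑.
module Resizing {p} (em : ExcludedMiddle p) where

  ∥_∥₀ : Set p → Set
  ∥ P ∥₀ = True (em {P})

  squash : {P : Set p} → P → ∥ P ∥₀
  squash = fromWitness

  unsquash : {P : Set p} → ∥ P ∥₀ → P
  unsquash = toWitness

module _ {X : Set} where

  NestedOrDisjoint : ∀ {ℓ} → Family X ℓ → Set (lsuc 0ℓ ⊔ ℓ)
  NestedOrDisjoint 𝓑 = ∀ B B' z → 𝓑 B → 𝓑 B' → B z → B' z → B ⊆ B' ⊎ B' ⊆ B

  ci-⊆-member : ∀ {ℓ} {𝓑 : Family X ℓ} {S} → ((𝓒 , _) : ci 𝓑 S) → ∀ B → 𝓒 B → S ⊆ B
  ci-⊆-member (_ , _ , S≗⋂𝓒 , _) B B∈𝓒 x x∈S = proj₁ (S≗⋂𝓒 x) x∈S B B∈𝓒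

  ci-⋂⊆ : ∀ {ℓ} {𝓑 : Family X ℓ} {S} → ((𝓒 , _) : ci 𝓑 S) → ∀ x → ⋂ 𝓒 x → S x
  ci-⋂⊆ (_ , _ , S≗⋂𝓒 , _) x = proj₂ (S≗⋂𝓒 x)

  ci-nonEmpty : ∀ {ℓ} {𝓑 : Family X ℓ} {S} → ci 𝓑 S → NonEmpty S
  ci-nonEmpty (_ , _ , _ , S≢∅) = S≢∅

  module Flatten {ℓ} (em : ExcludedMiddle (lsuc ℓ)) {𝓑 : Family X ℓ}
                 (nested : NestedOrDisjoint 𝓑)
                 (𝓒 : Family X (lsuc ℓ)) (𝓒-chain : IsChainIn (ci 𝓑) 𝓒) where
    open Resizing em
    open IsChainIn 𝓒-chain

    InWitnessingChain : Subset X → Set (lsuc ℓ)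
    InWitnessingChain B = Σ (Subset X) λ S → Σ (𝓒 S) λ S∈𝓒 → proj₁ (sub S S∈𝓒) B

    flat : Family X ℓ
    flat B = Lift ℓ ∥ InWitnessingChain B ∥₀

    witness : ∀ {B} → flat B → InWitnessingChain B
    witness = unsquash ∘ lower

    meet-via-smaller : ∀ {S S' B B'} (S∈𝓒 : 𝓒 S) (S'∈𝓒 : 𝓒 S') → S ⊆ S' →
                       proj₁ (sub S S∈𝓒) B → proj₁ (sub S' S'∈𝓒) B' → Σ X λ z → B z × B' z
    meet-via-smaller {S} {S'} S∈𝓒 S'∈𝓒 S⊆S' B∈ B'∈ with ci-nonEmpty (sub S S∈𝓒)
    ... | z , z∈S = z , ci-⊆-member (sub S S∈𝓒) _ B∈ z z∈S
                      , ci-⊆-member (sub S' S'∈𝓒) _ B'∈ z (S⊆S' z z∈S)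

    flat-meet : ∀ B B' → flat B → flat B' → Σ X λ z → B z × B' z
    flat-meet B B' B∈ B'∈ with witness B∈ | witness B'∈
    ... | S , S∈𝓒 , B∈ᵂ | S' , S'∈𝓒 , B'∈ᵂ with linear S S' S∈𝓒 S'∈𝓒
    ... | inj₁ S⊆S' = meet-via-smaller S∈𝓒 S'∈𝓒 S⊆S' B∈ᵂ B'∈ᵂ
    ... | inj₂ S'⊆S = map₂ swap (meet-via-smaller S'∈𝓒 S∈𝓒 S'⊆S B'∈ᵂ B∈ᵂ)

    flat-⊆𝓑 : ∀ B → flat B → 𝓑 B
    flat-⊆𝓑 B B∈ with witness B∈
    ... | S , S∈𝓒 , B∈ᵂ = IsChainIn.sub (proj₁ (proj₂ (sub S S∈𝓒))) B B∈ᵂ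

    flat-inhabited : Σ (Subset X) flat
    flat-inhabited with inhabited
    ... | S , S∈𝓒 with IsChainIn.inhabited (proj₁ (proj₂ (sub S S∈𝓒)))
    ... | B , B∈ᵂ = B , lift (squash (S , S∈𝓒 , B∈ᵂ))

    flat-isChain : IsChainIn 𝓑 flat
    flat-isChain = record
      { sub       = flat-⊆𝓑
      ; inhabited = flat-inhabited
      ; linear    = λ B B' B∈ B'∈ →
          let z , z∈B , z∈B' = flat-meet B B' B∈ B'∈
          in nested B B' z (flat-⊆𝓑 B B∈) (flat-⊆𝓑 B' B'∈) z∈B z∈B'
      }

    ⋂flat⇒⋂𝓒 : ∀ x → ⋂ flat x → ⋂ 𝓒 x
    ⋂flat⇒⋂𝓒 x x∈⋂ S S∈𝓒 =
      ci-⋂⊆ (sub S S∈𝓒) x (λ B B∈ᵂ → x∈⋂ B (lift (squash (S , S∈𝓒 , B∈ᵂ))))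

    ⋂𝓒⇒⋂flat : ∀ x → ⋂ 𝓒 x → ⋂ flat x
    ⋂𝓒⇒⋂flat x x∈⋂ B B∈ with witness B∈
    ... | S , S∈𝓒 , B∈ᵂ = ci-⊆-member (sub S S∈𝓒) B B∈ᵂ x (x∈⋂ S S∈𝓒)

  module _ {ℓ} (em : ExcludedMiddle (lsuc ℓ)) {𝓑 : Family X ℓ} (nested : NestedOrDisjoint 𝓑) where
    open Resizing em

    ci-chainIntersectionClosed : ChainIntersectionClosed (ci 𝓑)
    ci-chainIntersectionClosed 𝓒 𝓒-chain with em {Σ X (⋂ 𝓒)}
    ... | no  ⋂𝓒≡∅        = inj₁ ⋂𝓒≡∅
    ... | yes (x , x∈⋂𝓒) =
      inj₂ (⋂𝓒₀ , (flat , flat-isChain , ⋂𝓒₀≗⋂flat , x , squash x∈⋂𝓒) , λ _ → unsquash , squash)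
      where
      open Flatten em nested 𝓒 𝓒-chain
      ⋂𝓒₀ : Subset X
      ⋂𝓒₀ x = ∥ ⋂ 𝓒 x ∥₀
      ⋂𝓒₀≗⋂flat : ∀ x → (⋂𝓒₀ x → ⋂ flat x) × (⋂ flat x → ⋂𝓒₀ x)
      ⋂𝓒₀≗⋂flat x = ⋂𝓒⇒⋂flat x ∘ unsquash , squash ∘ ⋂flat⇒⋂𝓒 x

    ci-sphericallyComplete : SphericallyComplete 𝓑 → SphericallyComplete (ci 𝓑)
    ci-sphericallyComplete 𝓑-complete 𝓒 𝓒-chain =
      let x , x∈⋂flat = 𝓑-complete flat flat-isChain in x , ⋂flat⇒⋂𝓒 x x∈⋂flat
      where open Flatten em nested 𝓒 𝓒-chain

module _ {X : Set} {Γ : TotalOrder 0ℓ 0ℓ 0ℓ} {⊥Γ : TotalOrder.Carrier Γ}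
         {d : X → X → TotalOrder.Carrier Γ} (U : IsUltrametric X Γ ⊥Γ d) where
  open TotalOrder Γ
  open IsUltrametric U

  Ball-⊆ : ∀ {a b a' b'} z → d a b ≤ d a' b' →
           Ball Γ d a b z → Ball Γ d a' b' z → Ball Γ d a b ⊆ Ball Γ d a' b'
  Ball-⊆ {a} {b} {a'} {b'} z r≤r' z∈B z∈B' w w∈B = d-ultra a' z w (d a' b') z∈B' d[z,w]≤r'
    where
    d[z,w]≤r' : d z w ≤ d a' b'
    d[z,w]≤r' = trans (d-ultra z a w (d a b) (≤-respˡ-≈ (d-sym a z) z∈B) w∈B) r≤r'

  𝓑d-nestedOrDisjoint : NestedOrDisjoint (𝓑d Γ d)
  𝓑d-nestedOrDisjoint B B' z (lift (a , b , B⊆ , ⊆B)) (lift (a' , b' , B'⊆ , ⊆B')) z∈B z∈B'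
    with total (d a b) (d a' b')
  ... | inj₁ r≤r' = inj₁ λ w → ⊆B' w ∘ Ball-⊆ z r≤r' (B⊆ z z∈B) (B'⊆ z z∈B') w ∘ B⊆ w
  ... | inj₂ r'≤r = inj₂ λ w → ⊆B w ∘ Ball-⊆ z r'≤r (B'⊆ z z∈B') (B⊆ z z∈B) w ∘ B'⊆ w

theorem1p1 : ExcludedMiddle (lsuc (lsuc (lsuc 0ℓ))) →
    (X : Set) → X → (Γ : TotalOrder 0ℓ 0ℓ 0ℓ) → (⊥Γ : TotalOrder.Carrier Γ) →
    (d : X → X → TotalOrder.Carrier Γ) → IsUltrametric X Γ ⊥Γ d →
    ChainIntersectionClosed (ci (𝓑d Γ d))
    × (SphericallyComplete (𝓑d Γ d) → SphericallyComplete (ci (𝓑d Γ d)))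
theorem1p1 em _ _ _ _ _ U =
  ci-chainIntersectionClosed em′ (𝓑d-nestedOrDisjoint U) ,
  ci-sphericallyComplete em′ (𝓑d-nestedOrDisjoint U)
  where
  em′ : ExcludedMiddle (lsuc (lsuc 0ℓ))
  em′ = ExcludedMiddle-lower (lsuc (lsuc (lsuc 0ℓ))) em
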